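{- Let $p$ be a prime, $q=p^e$ with $e\ge1$, and $m$ an integer with $1\le m\le e$. Let $L_m(q)$ be the bipartite graph whose vertex set is the disjoint union of a point set $\mathbb{F}_q^{m+1}$ and a line set $\mathbb{F}_q^{m+1}$, with a point $P=(p_1,\dots,p_{m+1})$ adjacent to a line $L=[l_1,\dots,l_{m+1}]$ if and only if $l_k+p_k=p_1^{\,p^{k-2}}\,l_1$ for all $k=2,\dots,m+1$. Then the diameter of $L_m(q)$ is $2(m+1)$.
   Context: The diameter is the maximum over pairs of vertices of the length of a shortest path between them. -}

module Defs where

open import Level using (Level; _⊔_) renaming (suc to lsuc)
open import Data.Nat using (ℕ; zero; suc; _^_)
open import Data.Fin using (Fin; toℕ) renaming (zero to fzero; suc to fsuc)
open import Data.Sum using (_⊎_; inj₁; inj₂)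
open import Data.Product using (∃)
open import Data.Empty.Polymorphic using (⊥)
open import Relation.Nullary using (¬_)
open import Algebra.Bundles using (CommutativeRing)
open import Function.Bundles using (Bijection)
import Relation.Binary.PropositionalEquality as ≡

record Field (c ℓ : Level) : Set (lsuc (c ⊔ ℓ)) where
  field
    commutativeRing : CommutativeRing c ℓ
  open CommutativeRing commutativeRing public
  field
    0≉1     : ¬ (0# ≈ 1#)
    inverse : ∀ x → ¬ (x ≈ 0#) → ∃ λ y → (x * y) ≈ 1#

HasOrder : ∀ {c ℓ} → Field c ℓ → ℕ → Set (c ⊔ ℓ)
HasOrder F q = Bijection (Field.setoid F) (≡.setoid (Fin q))

module LGraph {c ℓ} (F : Field c ℓ) (p m : ℕ) where
  open Field F using (Carrier; _≈_; _+_; _*_; 1#)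

  pow : Carrier → ℕ → Carrier
  pow x zero    = 1#
  pow x (suc n) = x * pow x n

  -- points and lines: vectors in F^(m+1), coordinates indexed 0..m
  -- (coordinate index i corresponds to the paper's subscript i+1)
  Coord : Set c
  Coord = Fin (suc m) → Carrier

  -- P ~ L  iff  l_k + p_k = p_1^(p^(k-2)) l_1 for k = 2..m+1.
  -- Here k = i + 2 for i : Fin m, so the coordinate is fsuc i and the exponent p ^ toℕ i.
  Incident : Coord → Coord → Set ℓ
  Incident P L = ∀ (i : Fin m) →
    (L (fsuc i) + P (fsuc i)) ≈ (pow (P fzero) (p ^ toℕ i) * L fzero)

  Vertex : Set c
  Vertex = Coord ⊎ Coord

  _≈ᵥ_ : Vertex → Vertex → Set ℓ
  inj₁ a ≈ᵥ inj₁ b = ∀ i → a i ≈ b i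
  inj₂ a ≈ᵥ inj₂ b = ∀ i → a i ≈ b i
  inj₁ _ ≈ᵥ inj₂ _ = ⊥
  inj₂ _ ≈ᵥ inj₁ _ = ⊥

  Adj : Vertex → Vertex → Set ℓ
  Adj (inj₁ P) (inj₂ L) = Incident P L
  Adj (inj₂ L) (inj₁ P) = Incident P L
  Adj (inj₁ _) (inj₁ _) = ⊥
  Adj (inj₂ _) (inj₂ _) = ⊥

  data Walk : ℕ → Vertex → Vertex → Set (c ⊔ ℓ) where
    [] : ∀ {u v} → u ≈ᵥ v → Walk zero u v
    _∷_ : ∀ {n u w v} → Adj u w → Walk n w v → Walk (suc n) u v

-- Diameter of a graph given by adjacency, as exactly d:
-- every pair is joined by a walk of length ≤ d (so the distance is ≤ d),
-- and some pair has no walk of length < d (so its distance is exactly d).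
HasDiameter : ∀ {c ℓ} (F : Field c ℓ) (p m : ℕ) → ℕ → Set (c ⊔ ℓ)
HasDiameter F p m d =
  (∀ u v → ∃ λ n → n Data.Nat.≤ d Data.Product.× Walk n u v)
  Data.Product.× (∃ λ u → ∃ λ v → ∀ n → Walk n u v → d Data.Nat.≤ n)
  where open LGraph F p m

module Submission where

-- Points and lines are pairs (a, u) with a ∈ F and u ∈ Fᵐ.  Two points on a
-- common line x differ in their tails by x (ψ a' - ψ a), where
-- ψ t = (t, tᵖ, …, t^(p^(m-1))); hence the walks of length 2(n+1) from P to Q
-- correspond to ways of writing tail Q - tail P as z (ψ(head Q) - ψ(head P))
-- plus a combination of n differences ψ t - ψ(head Q), and similarly for lines.
--
-- Upper bound: for every b the differences ψ t - ψ b (t ∈ F) span Fᵐ, since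
-- a linear form killing them gives a nonzero polynomial Σᵢ aᵢ x^(pⁱ) - c of
-- degree p^(m-1) < q = p^e vanishing on all of F.  Gaussian elimination then
-- writes any vector with m differences (m - 1 besides a prescribed pivot, for
-- the walks between a point and a line).
--
-- Lower bound: F has characteristic p, so the maps φₖ t = t^(pᵏ) are additive.
-- Reaching (0, (0, …, 0, 1)) from the origin needs Σⱼ yⱼ φₖ tⱼ = 0 for k < m - 1
-- and = 1 for k = m - 1, impossible with fewer than m terms (the Moore matrix
-- argument); so these two points are at distance at least 2(m+1).

open import Defs
open import Level using (Level; _⊔_)
open import Algebra.Bundles using (CommutativeRing)
open import Data.Nat as ℕ using (ℕ; zero; suc; _≤_; _<_; z≤n; s≤s; _∸_; _!)
import Data.Nat.Properties as ℕP
open import Data.Nat.Properties using (_!*_!≢0)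
open import Data.Nat.Divisibility using (_∣_; divides; ∣⇒≤; ∣1⇒≡1; m∣m*n)
open import Data.Nat.DivMod using (m/n*n≡m)
open import Data.Nat.Primality using (Prime; euclidsLemma; prime⇒nonTrivial; prime⇒nonZero)
open import Data.Nat.Combinatorics using (_C_; nCk≡n!/k![n-k]!; k![n∸k]!∣n!; nCn≡1)
open import Data.Integer as ℤ using (ℤ; +_; -[1+_]; _⊖_)
import Data.Integer.Properties as ℤP
open import Data.Sign as Sign using (Sign)
open import Data.Maybe using (Maybe; just; nothing)
open import Data.Fin as Fin using (Fin; toℕ; fromℕ; fromℕ<; inject₁) renaming (zero to fzero; suc to fsuc)
import Data.Fin.Properties as FinP
open import Data.Fin.Permutation using (permutation)
open import Data.Vec.Functional using (head; tail) renaming (_∷_ to _◂_)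
open import Data.Product using (Σ; ∃; _,_; proj₁; proj₂; map₁)
open import Data.Sum using (_⊎_; inj₁; inj₂)
open import Data.List using (List; []; _∷_; length; map; tabulate)
import Data.List.Properties as ListP
open import Data.List.Relation.Unary.All using (All; []; _∷_)
import Data.List.Relation.Unary.All.Properties as AllP
open import Data.List.Relation.Unary.AllPairs using (AllPairs; []; _∷_)
import Data.List.Relation.Unary.AllPairs.Properties as AllPairsP
open import Data.Empty using (⊥-elim)
open import Function.Base using (_∘_)
open import Function.Bundles using (Bijection; Surjection)
open import Relation.Nullary using (¬_; Dec; yes; no)
open import Relation.Binary.Definitions using (tri<; tri≈; tri>)
import Relation.Binary.PropositionalEquality as ≡

module ℤ-Solver {c ℓ} (R : CommutativeRing c ℓ) where
  open CommutativeRing R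
  open import Algebra.Solver.Ring.AlmostCommutativeRing
  open import Algebra.Properties.Ring ring using (-‿distribˡ-*; -‿distribʳ-*; -‿involutive; -0#≈0#)
  open import Algebra.Properties.AbelianGroup +-abelianGroup using (⁻¹-∙-comm)
  open import Algebra.Properties.Semiring.Mult.TCOptimised semiring using (_×_; ×-homo-+; ×1-homo-*)
  open import Relation.Binary.Reasoning.Setoid setoid

  private
    ⟦_⟧ℤ : ℤ → Carrier
    ⟦ + n ⟧ℤ      = n × 1#
    ⟦ -[1+ n ] ⟧ℤ = - (suc n × 1#)

    signed : Sign → Carrier → Carrier
    signed Sign.+ x = x
    signed Sign.- x = - x

    signed-cong : ∀ s {x y} → x ≈ y → signed s x ≈ signed s y
    signed-cong Sign.+ x≈y = x≈y
    signed-cong Sign.- x≈y = -‿cong x≈y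

    signed-* : ∀ s t x y → signed (s Sign.* t) (x * y) ≈ signed s x * signed t y
    signed-* Sign.+ Sign.+ x y = refl
    signed-* Sign.+ Sign.- x y = -‿distribʳ-* x y
    signed-* Sign.- Sign.+ x y = -‿distribˡ-* x y
    signed-* Sign.- Sign.- x y = begin
      x * y             ≈⟨ -‿involutive (x * y) ⟨
      - - (x * y)       ≈⟨ -‿cong (-‿distribˡ-* x y) ⟩
      - (- x * y)       ≈⟨ -‿distribʳ-* (- x) y ⟩
      (- x) * (- y)     ∎

    ⟦◃⟧ : ∀ s n → ⟦ s ℤ.◃ n ⟧ℤ ≈ signed s (n × 1#)
    ⟦◃⟧ Sign.+ zero    = refl
    ⟦◃⟧ Sign.- zero    = sym -0#≈0#
    ⟦◃⟧ Sign.+ (suc n) = refl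
    ⟦◃⟧ Sign.- (suc n) = refl

    ⟦sign◃∣∣⟧ : ∀ i → ⟦ i ⟧ℤ ≈ signed (ℤ.sign i) (ℤ.∣ i ∣ × 1#)
    ⟦sign◃∣∣⟧ (+ n)    = refl
    ⟦sign◃∣∣⟧ -[1+ n ] = refl

    ⟦⟧-homo-* : ∀ i j → ⟦ i ℤ.* j ⟧ℤ ≈ ⟦ i ⟧ℤ * ⟦ j ⟧ℤ
    ⟦⟧-homo-* i j = begin
      ⟦ i ℤ.* j ⟧ℤ
        ≈⟨ ⟦◃⟧ (ℤ.sign i Sign.* ℤ.sign j) (ℤ.∣ i ∣ ℕ.* ℤ.∣ j ∣) ⟩
      signed (ℤ.sign i Sign.* ℤ.sign j) ((ℤ.∣ i ∣ ℕ.* ℤ.∣ j ∣) × 1#)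
        ≈⟨ signed-cong (ℤ.sign i Sign.* ℤ.sign j) (×1-homo-* ℤ.∣ i ∣ ℤ.∣ j ∣) ⟩
      signed (ℤ.sign i Sign.* ℤ.sign j) ((ℤ.∣ i ∣ × 1#) * (ℤ.∣ j ∣ × 1#))
        ≈⟨ signed-* (ℤ.sign i) (ℤ.sign j) _ _ ⟩
      signed (ℤ.sign i) (ℤ.∣ i ∣ × 1#) * signed (ℤ.sign j) (ℤ.∣ j ∣ × 1#)
        ≈⟨ *-cong (⟦sign◃∣∣⟧ i) (⟦sign◃∣∣⟧ j) ⟨
      ⟦ i ⟧ℤ * ⟦ j ⟧ℤ ∎

    ⟦⊖⟧ : ∀ m n → ⟦ m ⊖ n ⟧ℤ ≈ m × 1# - n × 1#
    ⟦⊖⟧ m zero = begin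
      m × 1#            ≈⟨ +-identityʳ _ ⟨
      m × 1# + 0#       ≈⟨ +-congˡ -0#≈0# ⟨
      m × 1# - 0#       ∎
    ⟦⊖⟧ zero (suc n) = sym (+-identityˡ _)
    ⟦⊖⟧ (suc m) (suc n) = begin
      ⟦ suc m ⊖ suc n ⟧ℤ                  ≡⟨ ≡.cong ⟦_⟧ℤ (ℤP.[1+m]⊖[1+n]≡m⊖n m n) ⟩
      ⟦ m ⊖ n ⟧ℤ                          ≈⟨ ⟦⊖⟧ m n ⟩
      m × 1# - n × 1#                     ≈⟨ +-identityˡ _ ⟨
      0# + (m × 1# - n × 1#)              ≈⟨ +-congʳ (-‿inverseʳ 1#) ⟨
      (1# - 1#) + (m × 1# - n × 1#)       ≈⟨ +-assoc 1# (- 1#) _ ⟩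
      1# + (- 1# + (m × 1# - n × 1#))     ≈⟨ +-congˡ (+-comm (- 1#) _) ⟩
      1# + ((m × 1# - n × 1#) - 1#)       ≈⟨ +-congˡ (+-assoc (m × 1#) _ _) ⟩
      1# + (m × 1# + (- (n × 1#) - 1#))   ≈⟨ +-assoc 1# _ _ ⟨
      (1# + m × 1#) + (- (n × 1#) - 1#)   ≈⟨ +-congˡ (+-comm (- (n × 1#)) (- 1#)) ⟩
      (1# + m × 1#) + (- 1# - n × 1#)     ≈⟨ +-congˡ (⁻¹-∙-comm 1# (n × 1#)) ⟩
      (1# + m × 1#) - (1# + n × 1#)       ≈⟨ +-cong (×-homo-+ 1# 1 m) (-‿cong (×-homo-+ 1# 1 n)) ⟨
      suc m × 1# - suc n × 1#             ∎

    ⟦⟧-homo-+ : ∀ i j → ⟦ i ℤ.+ j ⟧ℤ ≈ ⟦ i ⟧ℤ + ⟦ j ⟧ℤ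
    ⟦⟧-homo-+ (+ m)    (+ n)    = ×-homo-+ 1# m n
    ⟦⟧-homo-+ (+ m)    -[1+ n ] = ⟦⊖⟧ m (suc n)
    ⟦⟧-homo-+ -[1+ m ] (+ n)    = trans (⟦⊖⟧ n (suc m)) (+-comm _ _)
    ⟦⟧-homo-+ -[1+ m ] -[1+ n ] = begin
      - (suc (suc (m ℕ.+ n)) × 1#)        ≡⟨ ≡.cong (λ k → - (suc k × 1#)) (ℕP.+-suc m n) ⟨
      - ((suc m ℕ.+ suc n) × 1#)          ≈⟨ -‿cong (×-homo-+ 1# (suc m) (suc n)) ⟩
      - (suc m × 1# + suc n × 1#)         ≈⟨ ⁻¹-∙-comm _ _ ⟨
      - (suc m × 1#) - (suc n × 1#)       ∎

    ⟦⟧-homo-- : ∀ i → ⟦ ℤ.- i ⟧ℤ ≈ - ⟦ i ⟧ℤ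
    ⟦⟧-homo-- (+ zero)  = sym -0#≈0#
    ⟦⟧-homo-- (+ suc n) = refl
    ⟦⟧-homo-- -[1+ n ]  = sym (-‿involutive _)

    ℤ⟶R : ℤ.+-*-rawRing -Raw-AlmostCommutative⟶ fromCommutativeRing R
    ℤ⟶R = record
      { ⟦_⟧    = ⟦_⟧ℤ
      ; +-homo = ⟦⟧-homo-+
      ; *-homo = ⟦⟧-homo-*
      ; -‿homo = ⟦⟧-homo--
      ; 0-homo = refl
      ; 1-homo = refl
      }

    ⟦⟧-≟ : ∀ i j → Maybe (⟦ i ⟧ℤ ≈ ⟦ j ⟧ℤ)
    ⟦⟧-≟ i j with i ℤ.≟ j
    ... | yes ≡.refl = just refl
    ... | no _       = nothing

  open import Algebra.Solver.Ring ℤ.+-*-rawRing (fromCommutativeRing R) ℤ⟶R ⟦⟧-≟ public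

module FieldProperties {c ℓ} (F : Field c ℓ) where
  open Field F public hiding (zero)
  open ℤ-Solver commutativeRing public
  open import Relation.Binary.Reasoning.Setoid setoid public
  open import Algebra.Properties.Semiring.Mult semiring using (_×_)

  x≉0∧x*y≈0⇒y≈0 : ∀ {x y} → ¬ x ≈ 0# → x * y ≈ 0# → y ≈ 0#
  x≉0∧x*y≈0⇒y≈0 {x} {y} x≉0 xy≈0 with inverse x x≉0
  ... | x⁻¹ , xx⁻¹≈1 = begin
    y               ≈⟨ *-identityˡ y ⟨
    1# * y          ≈⟨ *-congʳ xx⁻¹≈1 ⟨
    (x * x⁻¹) * y   ≈⟨ solve 3 (λ x y z → (x :* z) :* y := z :* (x :* y)) refl x y x⁻¹ ⟩
    x⁻¹ * (x * y)   ≈⟨ *-congˡ xy≈0 ⟩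
    x⁻¹ * 0#        ≈⟨ zeroʳ x⁻¹ ⟩
    0#              ∎

  x-y≈0⇒x≈y : ∀ {x y} → x - y ≈ 0# → x ≈ y
  x-y≈0⇒x≈y {x} {y} x-y≈0 = begin
    x               ≈⟨ solve 2 (λ x y → x := (x :- y) :+ y) refl x y ⟩
    (x - y) + y     ≈⟨ +-congʳ x-y≈0 ⟩
    0# + y          ≈⟨ +-identityˡ y ⟩
    y               ∎

  ofℕ : ℕ → Carrier
  ofℕ n = n × 1#

  1≉0 : ¬ 1# ≈ 0#
  1≉0 1≈0 = 0≉1 (sym 1≈0)

prime⇒1<p : ∀ {p} → Prime p → 1 < p
prime⇒1<p {p} p-prime = ℕ.nonTrivial⇒n>1 p {{prime⇒nonTrivial p-prime}}

p∤j! : ∀ {p} → Prime p → ∀ {j} → j < p → ¬ p ∣ j !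
p∤j! p-prime {zero} _ p∣1 with ∣1⇒≡1 p∣1
... | ≡.refl = ℕP.<-irrefl ≡.refl (prime⇒1<p p-prime)
p∤j! p-prime {suc j} j<p p∣j! with euclidsLemma (suc j) (j !) p-prime p∣j!
... | inj₁ p∣1+j = ℕP.<-irrefl ≡.refl (ℕP.<-≤-trans j<p (∣⇒≤ p∣1+j))
... | inj₂ p∣j!′ = p∤j! p-prime (ℕP.<-trans (ℕP.n<1+n j) j<p) p∣j!′

-- p C k · k! (p - k)! = p!, and p divides neither factorial.
p∣pCk : ∀ {p} → Prime p → ∀ {k} → 0 < k → k < p → p ∣ p C k
p∣pCk {p@(suc p′)} p-prime {k} 0<k k<p with euclidsLemma (p C k) (k ! ℕ.* (p ∸ k) !) p-prime p∣pCk·k!·[p-k]!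
  where
  instance _ = k !* (p ∸ k) !≢0
  p∣pCk·k!·[p-k]! : p ∣ (p C k) ℕ.* (k ! ℕ.* (p ∸ k) !)
  p∣pCk·k!·[p-k]! = ≡.subst (p ∣_)
    (≡.sym (≡.trans (≡.cong (ℕ._* (k ! ℕ.* (p ∸ k) !)) (nCk≡n!/k![n-k]! (ℕP.<⇒≤ k<p)))
                    (m/n*n≡m (k![n∸k]!∣n! (ℕP.<⇒≤ k<p)))))
    (m∣m*n (p′ !))
... | inj₁ p∣pCk = p∣pCk
... | inj₂ p∣k!·[p-k]! with euclidsLemma (k !) ((p ∸ k) !) p-prime p∣k!·[p-k]!
...   | inj₁ p∣k! = ⊥-elim (p∤j! p-prime k<p p∣k!)
...   | inj₂ p∣[p-k]! = ⊥-elim (p∤j! p-prime (ℕP.∸-monoʳ-< 0<k (ℕP.<⇒≤ k<p)) p∣[p-k]!)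

^-injectiveʳ : ∀ {p} → 1 < p → ∀ i j → p ℕ.^ i ≡.≡ p ℕ.^ j → i ≡.≡ j
^-injectiveʳ {p} 1<p i j pⁱ≡pʲ with ℕP.<-cmp i j
... | tri< i<j _ _ = ⊥-elim (ℕP.<-irrefl pⁱ≡pʲ (ℕP.^-monoʳ-< p 1<p i<j))
... | tri≈ _ i≡j _ = i≡j
... | tri> _ _ j<i = ⊥-elim (ℕP.<-irrefl (≡.sym pⁱ≡pʲ) (ℕP.^-monoʳ-< p 1<p j<i))

module FiniteField {c ℓ} (F : Field c ℓ) {q : ℕ} (F↔Fin : HasOrder F q) where
  open FieldProperties F
  open import Algebra.Properties.Semiring.Mult semiring using (×1-homo-*)
  open import Algebra.Properties.CommutativeMonoid.Sum +-commutativeMonoid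
    using (sum; sum-permute; ∑-distrib-+; sum-cong-≋; sum-replicate)

  index : Carrier → Fin q
  index = Bijection.to F↔Fin

  element : Fin q → Carrier
  element = Surjection.to⁻ (Bijection.surjection F↔Fin)

  index-element : ∀ i → index (element i) ≡.≡ i
  index-element = Surjection.to∘to⁻ (Bijection.surjection F↔Fin)

  element-index : ∀ x → element (index x) ≈ x
  element-index x = Bijection.injective F↔Fin (index-element (index x))

  element-injective : ∀ {i j} → element i ≈ element j → i ≡.≡ j
  element-injective {i} {j} eq =
    ≡.trans (≡.sym (index-element i)) (≡.trans (Bijection.cong F↔Fin eq) (index-element j))

  _≟0 : ∀ x → Dec (x ≈ 0#)
  x ≟0 with index x FinP.≟ index 0#
  ... | yes eq = yes (Bijection.injective F↔Fin eq)
  ... | no ¬eq = no (¬eq ∘ Bijection.cong F↔Fin)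

  -- Translation by 1 permutes the field, so Σₓ (x + 1) = Σₓ x.
  q≈0 : ofℕ q ≈ 0#
  q≈0 = begin
    ofℕ q                                   ≈⟨ sum-replicate q ⟨
    sum {q} (λ _ → 1#)                      ≈⟨ solve 2 (λ S T → T := (S :+ T) :- S) refl (sum element) _ ⟩
    (sum element + sum {q} (λ _ → 1#)) - sum element
                                            ≈⟨ +-congʳ (∑-distrib-+ element (λ _ → 1#)) ⟨
    sum (λ i → element i + 1#) - sum element
                                            ≈⟨ +-congʳ (sum-cong-≋ (λ i → element-index (element i + 1#))) ⟨
    sum (element ∘ shift) - sum element     ≈⟨ +-congʳ (sum-permute element (permutation shift unshift shift∘unshift unshift∘shift)) ⟨
    sum element - sum element               ≈⟨ -‿inverseʳ _ ⟩
    0#                                      ∎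
    where
    shift unshift : Fin q → Fin q
    shift i = index (element i + 1#)
    unshift i = index (element i - 1#)
    shift∘unshift : ∀ i → shift (unshift i) ≡.≡ i
    shift∘unshift i = ≡.trans (Bijection.cong F↔Fin (trans (+-congʳ (element-index _))
      (solve 2 (λ a b → a :- b :+ b := a) refl (element i) 1#))) (index-element i)
    unshift∘shift : ∀ i → unshift (shift i) ≡.≡ i
    unshift∘shift i = ≡.trans (Bijection.cong F↔Fin (trans (+-congʳ (element-index _))
      (solve 2 (λ a b → a :+ b :- b := a) refl (element i) 1#))) (index-element i)

  p^e-order⇒p≈0 : ∀ p e → q ≡.≡ p ℕ.^ e → ofℕ p ≈ 0#
  p^e-order⇒p≈0 p e ≡.refl = go e q≈0
    where
    go : ∀ e → ofℕ (p ℕ.^ e) ≈ 0# → ofℕ p ≈ 0#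
    go zero    1+0≈0 = ⊥-elim (1≉0 (trans (sym (+-identityʳ 1#)) 1+0≈0))
    go (suc e) pᵉ⁺¹≈0 with ofℕ p ≟0
    ... | yes p≈0 = p≈0
    ... | no  p≉0 = go e (x≉0∧x*y≈0⇒y≈0 p≉0 (trans (sym (×1-homo-* p (p ℕ.^ e))) pᵉ⁺¹≈0))

module FreshmansDream {c ℓ} (R : CommutativeRing c ℓ) where
  open CommutativeRing R
  open import Algebra.Properties.Semiring.Mult semiring using (_×_)
  open import Algebra.Properties.Semiring.Exp semiring using (_^_)
  open import Algebra.Properties.Semiring.Sum semiring using (sum; sum-init-last; sum-cong-≋; sum-replicate-zero)
  open import Algebra.Properties.CommutativeSemiring.Binomial commutativeSemiring using (theorem; binomialTerm)
  open import Relation.Binary.Reasoning.Setoid setoid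

  freshman : ∀ n x y → (∀ {k} → 0 < k → k < suc n → (suc n C k) × (x ^ k * y ^ (suc n ∸ k)) ≈ 0#) →
             (x + y) ^ suc n ≈ x ^ suc n + y ^ suc n
  freshman n x y middle≈0 = begin
    (x + y) ^ suc n                                     ≈⟨ theorem (suc n) x y ⟩
    term fzero + sum (term ∘ fsuc)                      ≈⟨ +-congˡ (sum-init-last (term ∘ fsuc)) ⟩
    term fzero + (sum (term ∘ fsuc ∘ inject₁) + term (fromℕ (suc n)))
                                                        ≈⟨ +-congˡ (+-congʳ (trans (sum-cong-≋ middle) (sum-replicate-zero n))) ⟩
    term fzero + (0# + term (fromℕ (suc n)))            ≈⟨ +-congˡ (+-identityˡ _) ⟩
    term fzero + term (fromℕ (suc n))                   ≈⟨ +-cong first last ⟩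
    y ^ suc n + x ^ suc n                               ≈⟨ +-comm _ _ ⟩
    x ^ suc n + y ^ suc n                               ∎
    where
    term = binomialTerm x y (suc n)
    middle : ∀ i → term (fsuc (inject₁ i)) ≈ 0#
    middle i = middle≈0 (s≤s z≤n) (s≤s (≡.subst (_< n) (≡.sym (FinP.toℕ-inject₁ i)) (FinP.toℕ<n i)))
    first : term fzero ≈ y ^ suc n
    first = begin
      (suc n C 0) × (1# * y ^ suc n)   ≈⟨ +-identityʳ _ ⟩
      1# * y ^ suc n                   ≈⟨ *-identityˡ _ ⟩
      y ^ suc n                        ∎
    last : term (fromℕ (suc n)) ≈ x ^ suc n
    last = begin
      term (fromℕ (suc n))
        ≡⟨ ≡.cong (λ k → (suc n C k) × (x ^ k * y ^ (suc n ∸ k))) (FinP.toℕ-fromℕ (suc n)) ⟩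
      (suc n C suc n) × (x ^ suc n * y ^ (suc n ∸ suc n))
        ≡⟨ ≡.cong₂ (λ a b → a × (x ^ suc n * y ^ b)) (nCn≡1 (suc n)) (ℕP.n∸n≡0 n) ⟩
      1 × (x ^ suc n * 1#)
        ≈⟨ +-identityʳ _ ⟩
      x ^ suc n * 1#
        ≈⟨ *-identityʳ _ ⟩
      x ^ suc n ∎

module Frobenius {c ℓ} (F : Field c ℓ) {p : ℕ} (p-prime : Prime p)
                 (p≈0 : Field._≈_ F (FieldProperties.ofℕ F p) (Field.0# F)) where
  open FieldProperties F
  open FreshmansDream commutativeRing using (freshman)
  open import Algebra.Properties.Semiring.Mult semiring using (_×_; ×1-homo-*; ×-assoc-*; ×-congʳ)
  open import Algebra.Properties.Semiring.Exp semiring using (_^_; ^-congˡ; ^-assocʳ)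
  open import Algebra.Properties.CommutativeSemiring.Exp commutativeSemiring using (^-distrib-*)

  n×x≈ofℕn*x : ∀ n x → n × x ≈ ofℕ n * x
  n×x≈ofℕn*x n x = begin
    n × x            ≈⟨ ×-congʳ n (*-identityˡ x) ⟨
    n × (1# * x)     ≈⟨ ×-assoc-* n 1# x ⟨
    ofℕ n * x        ∎

  middle-binomial≈0 : ∀ x y {k} → 0 < k → k < p → (p C k) × (x ^ k * y ^ (p ∸ k)) ≈ 0#
  middle-binomial≈0 x y {k} 0<k k<p with p∣pCk p-prime 0<k k<p
  ... | divides d pCk≡dp = begin
    (p C k) × z                  ≈⟨ n×x≈ofℕn*x (p C k) z ⟩
    ofℕ (p C k) * z              ≡⟨ ≡.cong (λ n → ofℕ n * z) pCk≡dp ⟩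
    ofℕ (d ℕ.* p) * z            ≈⟨ *-congʳ (×1-homo-* d p) ⟩
    (ofℕ d * ofℕ p) * z          ≈⟨ *-congʳ (trans (*-congˡ p≈0) (zeroʳ _)) ⟩
    0# * z                       ≈⟨ zeroˡ z ⟩
    0#                           ∎
    where z = x ^ k * y ^ (p ∸ k)

  frobenius : ∀ x y → (x + y) ^ p ≈ x ^ p + y ^ p
  frobenius x y = ≡.subst (λ n → (x + y) ^ n ≈ x ^ n + y ^ n) p′+1≡p
    (freshman p′ x y (≡.subst (λ n → ∀ {k} → 0 < k → k < n → (n C k) × (x ^ k * y ^ (n ∸ k)) ≈ 0#)
                              (≡.sym p′+1≡p) (middle-binomial≈0 x y)))
    where
    p′ = ℕ.pred p
    p′+1≡p : suc p′ ≡.≡ p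
    p′+1≡p = ℕP.suc-pred p {{prime⇒nonZero p-prime}}

  φ : ℕ → Carrier → Carrier
  φ k x = x ^ (p ℕ.^ k)

  φ-suc : ∀ k x → φ (suc k) x ≈ φ k (x ^ p)
  φ-suc k x = sym (^-assocʳ x p (p ℕ.^ k))

  φ-cong : ∀ k {x y} → x ≈ y → φ k x ≈ φ k y
  φ-cong k = ^-congˡ (p ℕ.^ k)

  φ-+ : ∀ k x y → φ k (x + y) ≈ φ k x + φ k y
  φ-+ zero x y = trans (*-identityʳ _) (sym (+-cong (*-identityʳ x) (*-identityʳ y)))
  φ-+ (suc k) x y = begin
    φ (suc k) (x + y)          ≈⟨ φ-suc k (x + y) ⟩
    φ k ((x + y) ^ p)          ≈⟨ φ-cong k (frobenius x y) ⟩
    φ k (x ^ p + y ^ p)        ≈⟨ φ-+ k (x ^ p) (y ^ p) ⟩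
    φ k (x ^ p) + φ k (y ^ p)  ≈⟨ +-cong (φ-suc k x) (φ-suc k y) ⟨
    φ (suc k) x + φ (suc k) y  ∎

  φ-* : ∀ k x y → φ k (x * y) ≈ φ k x * φ k y
  φ-* k x y = ^-distrib-* x y (p ℕ.^ k)

  φ-0 : ∀ k → φ k 0# ≈ 0#
  φ-0 k with p ℕ.^ k in pᵏ≡
  ... | zero  = ⊥-elim (ℕ.≢-nonZero⁻¹ p {{prime⇒nonZero p-prime}} (ℕP.m^n≡0⇒m≡0 p k pᵏ≡))
  ... | suc _ = zeroˡ _

  φ-- : ∀ k x y → φ k (x - y) ≈ φ k x - φ k y
  φ-- k x y = begin
    φ k (x - y)                       ≈⟨ solve 2 (λ a b → a := (a :+ b) :- b) refl _ (φ k y) ⟩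
    (φ k (x - y) + φ k y) - φ k y     ≈⟨ +-congʳ (φ-+ k (x - y) y) ⟨
    φ k ((x - y) + y) - φ k y         ≈⟨ +-congʳ (φ-cong k (solve 2 (λ x y → (x :- y) :+ y := x) refl x y)) ⟩
    φ k x - φ k y                     ∎

open import Data.Product using (_×_)

module Vectors {c ℓ} (F : Field c ℓ) where
  open FieldProperties F

  _·_ : ∀ {k} → (Fin k → Carrier) → (Fin k → Carrier) → Carrier
  _·_ {zero}  a b = 0#
  _·_ {suc k} a b = a fzero * b fzero + (a ∘ fsuc) · (b ∘ fsuc)

  ·-congˡ : ∀ {k} (a : Fin k → Carrier) {b d} → (∀ i → b i ≈ d i) → a · b ≈ a · d
  ·-congˡ {zero}  a b≈d = refl
  ·-congˡ {suc k} a b≈d = +-cong (*-congˡ (b≈d fzero)) (·-congˡ (a ∘ fsuc) (b≈d ∘ fsuc))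

  0·b≈0 : ∀ {k} (b : Fin k → Carrier) → (λ _ → 0#) · b ≈ 0#
  0·b≈0 {zero}  b = refl
  0·b≈0 {suc k} b = begin
    0# * b fzero + (λ _ → 0#) · (b ∘ fsuc)   ≈⟨ +-cong (zeroˡ _) (0·b≈0 (b ∘ fsuc)) ⟩
    0# + 0#                                  ≈⟨ +-identityˡ 0# ⟩
    0#                                       ∎

  a·[b-sd]≈a·b-s[a·d] : ∀ {k} (a b d : Fin k → Carrier) s →
                a · (λ i → b i - s * d i) ≈ a · b - s * (a · d)
  a·[b-sd]≈a·b-s[a·d] {zero}  a b d s =
    solve 1 (λ s → con (ℤ.+ 0) := con (ℤ.+ 0) :- s :* con (ℤ.+ 0)) refl s
  a·[b-sd]≈a·b-s[a·d] {suc k} a b d s = begin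
    a₀ * (b₀ - s * d₀) + a' · (λ i → b' i - s * d' i)  ≈⟨ +-congˡ (a·[b-sd]≈a·b-s[a·d] a' b' d' s) ⟩
    a₀ * (b₀ - s * d₀) + (a' · b' - s * (a' · d'))     ≈⟨ solve 6 (λ a b d s X Y →
                                                             a :* (b :- s :* d) :+ (X :- s :* Y)
                                                          := (a :* b :+ X) :- s :* (a :* d :+ Y))
                                                          refl a₀ b₀ d₀ s (a' · b') (a' · d') ⟩
    (a₀ * b₀ + a' · b') - s * (a₀ * d₀ + a' · d')      ∎
    where a₀ = a fzero; b₀ = b fzero; d₀ = d fzero
          a' = a ∘ fsuc; b' = b ∘ fsuc; d' = d ∘ fsuc

  a·[b-d]≈a·b-a·d : ∀ {k} (a b d : Fin k → Carrier) → a · (λ i → b i - d i) ≈ a · b - a · d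
  a·[b-d]≈a·b-a·d a b d = begin
    a · (λ i → b i - d i)         ≈⟨ ·-congˡ a (λ i → +-congˡ (-‿cong (*-identityˡ (d i)))) ⟨
    a · (λ i → b i - 1# * d i)    ≈⟨ a·[b-sd]≈a·b-s[a·d] a b d 1# ⟩
    a · b - 1# * (a · d)          ≈⟨ +-congˡ (-‿cong (*-identityˡ _)) ⟩
    a · b - a · d                 ∎

-- Polynomials are lists of coefficients, constant term first.
module Polynomials {c ℓ} (F : Field c ℓ) where
  open FieldProperties F
  open Vectors F
  open import Algebra.Properties.Semiring.Exp semiring using (_^_)

  Poly : Set c
  Poly = List Carrier

  eval : Poly → Carrier → Carrier
  eval []       x = 0#
  eval (a ∷ as) x = a + x * eval as x

  IsZero : Poly → Set (c ⊔ ℓ)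
  IsZero = All (_≈ 0#)

  quotient : Poly → Carrier → Poly
  quotient []           r = []
  quotient (a ∷ [])     r = []
  quotient (a ∷ b ∷ bs) r = eval (b ∷ bs) r ∷ quotient (b ∷ bs) r

  length-quotient : ∀ a P r → length (quotient (a ∷ P) r) ≡.≡ length P
  length-quotient a []       r = ≡.refl
  length-quotient a (b ∷ bs) r = ≡.cong suc (length-quotient b bs r)

  eval-quotient : ∀ a P r x → eval (a ∷ P) x ≈ (x - r) * eval (quotient (a ∷ P) r) x + eval (a ∷ P) r
  eval-quotient a [] r x =
    solve 3 (λ a r x → a :+ x :* con (ℤ.+ 0) := (x :- r) :* con (ℤ.+ 0) :+ (a :+ r :* con (ℤ.+ 0)))
      refl a r x
  eval-quotient a (b ∷ bs) r x = begin
    a + x * eval (b ∷ bs) x                          ≈⟨ +-congˡ (*-congˡ (eval-quotient b bs r x)) ⟩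
    a + x * ((x - r) * Q + B)                        ≈⟨ solve 5 (λ a x r Q B →
                                                           a :+ x :* ((x :- r) :* Q :+ B)
                                                        := (x :- r) :* (B :+ x :* Q) :+ (a :+ r :* B))
                                                        refl a x r Q B ⟩
    (x - r) * (B + x * Q) + (a + r * B)              ∎
    where Q = eval (quotient (b ∷ bs) r) x
          B = eval (b ∷ bs) r

  root-quotient : ∀ {a P r x} → ¬ r ≈ x → eval (a ∷ P) r ≈ 0# → eval (a ∷ P) x ≈ 0# →
                  eval (quotient (a ∷ P) r) x ≈ 0#
  root-quotient {a} {P} {r} {x} r≉x Pr≈0 Px≈0 =
    x≉0∧x*y≈0⇒y≈0 (λ x-r≈0 → r≉x (sym (x-y≈0⇒x≈y x-r≈0))) (begin
      (x - r) * Q                                ≈⟨ solve 2 (λ A B → A := (A :+ B) :- B) refl _ (eval (a ∷ P) r) ⟩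
      ((x - r) * Q + eval (a ∷ P) r) - eval (a ∷ P) r  ≈⟨ +-congʳ (eval-quotient a P r x) ⟨
      eval (a ∷ P) x - eval (a ∷ P) r            ≈⟨ +-cong Px≈0 (-‿cong Pr≈0) ⟩
      0# - 0#                                    ≈⟨ -‿inverseʳ 0# ⟩
      0#                                         ∎)
    where Q = eval (quotient (a ∷ P) r) x

  quotient-zero⇒zero : ∀ a P r → IsZero (quotient (a ∷ P) r) → eval (a ∷ P) r ≈ 0# → IsZero (a ∷ P)
  quotient-zero⇒zero a [] r _ Pr≈0 = trans (sym (trans (+-congˡ (zeroʳ r)) (+-identityʳ a))) Pr≈0 ∷ []
  quotient-zero⇒zero a (b ∷ bs) r (Qb≈0 ∷ Q≈0) Pr≈0 = a≈0 ∷ quotient-zero⇒zero b bs r Q≈0 Qb≈0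
    where
    a≈0 : a ≈ 0#
    a≈0 = begin
      a                         ≈⟨ +-identityʳ a ⟨
      a + 0#                    ≈⟨ +-congˡ (trans (*-congˡ Qb≈0) (zeroʳ r)) ⟨
      a + r * eval (b ∷ bs) r   ≈⟨ Pr≈0 ⟩
      0#                        ∎

  length≤#roots⇒zero : ∀ (rs : List Carrier) P → length P ≤ length rs →
                       AllPairs (λ x y → ¬ x ≈ y) rs → All (λ r → eval P r ≈ 0#) rs → IsZero P
  length≤#roots⇒zero rs [] _ _ _ = []
  length≤#roots⇒zero (r ∷ rs) (a ∷ P) (s≤s |P|≤|rs|) (r≉rs ∷ distinct) (Pr≈0 ∷ Prs≈0) =
    quotient-zero⇒zero a P r
      (length≤#roots⇒zero rs (quotient (a ∷ P) r) |Q|≤|rs| distinct (roots r≉rs Prs≈0)) Pr≈0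
    where
    |Q|≤|rs| : length (quotient (a ∷ P) r) ≤ length rs
    |Q|≤|rs| = ≡.subst (_≤ length rs) (≡.sym (length-quotient a P r)) |P|≤|rs|
    roots : ∀ {xs} → All (λ x → ¬ r ≈ x) xs → All (λ x → eval (a ∷ P) x ≈ 0#) xs →
            All (λ x → eval (quotient (a ∷ P) r) x ≈ 0#) xs
    roots []               []             = []
    roots (r≉x ∷ r≉xs)     (Px≈0 ∷ Pxs≈0) = root-quotient {a} {P} r≉x Pr≈0 Px≈0 ∷ roots r≉xs Pxs≈0

  coeff : Poly → ℕ → Carrier
  coeff []       j       = 0#
  coeff (a ∷ as) zero    = a
  coeff (a ∷ as) (suc j) = coeff as j

  coeff-zero : ∀ P j → IsZero P → coeff P j ≈ 0#
  coeff-zero []      j       _            = refl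
  coeff-zero (a ∷ P) zero    (a≈0 ∷ _)    = a≈0
  coeff-zero (a ∷ P) (suc j) (_ ∷ P≈0)    = coeff-zero P j P≈0

  _⊕_ : Poly → Poly → Poly
  []       ⊕ bs       = bs
  (a ∷ as) ⊕ []       = a ∷ as
  (a ∷ as) ⊕ (b ∷ bs) = (a + b) ∷ (as ⊕ bs)

  eval-⊕ : ∀ as bs x → eval (as ⊕ bs) x ≈ eval as x + eval bs x
  eval-⊕ []       bs       x = sym (+-identityˡ _)
  eval-⊕ (a ∷ as) []       x = sym (+-identityʳ _)
  eval-⊕ (a ∷ as) (b ∷ bs) x = begin
    (a + b) + x * eval (as ⊕ bs) x            ≈⟨ +-congˡ (*-congˡ (eval-⊕ as bs x)) ⟩
    (a + b) + x * (eval as x + eval bs x)     ≈⟨ solve 5 (λ a b x A B →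
                                                    (a :+ b) :+ x :* (A :+ B)
                                                 := (a :+ x :* A) :+ (b :+ x :* B))
                                                 refl a b x (eval as x) (eval bs x) ⟩
    (a + x * eval as x) + (b + x * eval bs x) ∎

  coeff-⊕ : ∀ as bs j → coeff (as ⊕ bs) j ≈ coeff as j + coeff bs j
  coeff-⊕ []       bs       j       = sym (+-identityˡ _)
  coeff-⊕ (a ∷ as) []       zero    = sym (+-identityʳ _)
  coeff-⊕ (a ∷ as) []       (suc j) = sym (+-identityʳ _)
  coeff-⊕ (a ∷ as) (b ∷ bs) zero    = refl
  coeff-⊕ (a ∷ as) (b ∷ bs) (suc j) = coeff-⊕ as bs j

  length-⊕ : ∀ as bs {n} → length as ≤ n → length bs ≤ n → length (as ⊕ bs) ≤ n
  length-⊕ []       bs       _           |bs|≤n      = |bs|≤n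
  length-⊕ (a ∷ as) []       |as|≤n      _           = |as|≤n
  length-⊕ (a ∷ as) (b ∷ bs) (s≤s |as|≤n) (s≤s |bs|≤n) = s≤s (length-⊕ as bs |as|≤n |bs|≤n)

  monomial : Carrier → ℕ → Poly
  monomial a zero    = a ∷ []
  monomial a (suc n) = 0# ∷ monomial a n

  length-monomial : ∀ a n → length (monomial a n) ≡.≡ suc n
  length-monomial a zero    = ≡.refl
  length-monomial a (suc n) = ≡.cong suc (length-monomial a n)

  eval-monomial : ∀ a n x → eval (monomial a n) x ≈ a * x ^ n
  eval-monomial a zero x = solve 2 (λ a x → a :+ x :* con (ℤ.+ 0) := a :* con (ℤ.+ 1)) refl a x
  eval-monomial a (suc n) x = begin
    0# + x * eval (monomial a n) x   ≈⟨ +-congˡ (*-congˡ (eval-monomial a n x)) ⟩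
    0# + x * (a * x ^ n)             ≈⟨ solve 3 (λ a x y → con (ℤ.+ 0) :+ x :* (a :* y) := a :* (x :* y))
                                          refl a x (x ^ n) ⟩
    a * (x * x ^ n)                  ∎

  coeff-monomial-same : ∀ a n → coeff (monomial a n) n ≈ a
  coeff-monomial-same a zero    = refl
  coeff-monomial-same a (suc n) = coeff-monomial-same a n

  coeff-monomial-other : ∀ a n j → ¬ j ≡.≡ n → coeff (monomial a n) j ≈ 0#
  coeff-monomial-other a zero    zero    j≢n = ⊥-elim (j≢n ≡.refl)
  coeff-monomial-other a zero    (suc j) _   = refl
  coeff-monomial-other a (suc n) zero    _   = refl
  coeff-monomial-other a (suc n) (suc j) j≢n = coeff-monomial-other a n j (j≢n ∘ ≡.cong suc)

  sparse : ∀ {k} → (Fin k → Carrier) → (Fin k → ℕ) → Poly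
  sparse {zero}  a E = []
  sparse {suc k} a E = monomial (a fzero) (E fzero) ⊕ sparse (a ∘ fsuc) (E ∘ fsuc)

  eval-sparse : ∀ {k} (a : Fin k → Carrier) E x → eval (sparse a E) x ≈ a · (λ i → x ^ E i)
  eval-sparse {zero}  a E x = refl
  eval-sparse {suc k} a E x = begin
    eval (monomial (a fzero) (E fzero) ⊕ sparse (a ∘ fsuc) (E ∘ fsuc)) x
      ≈⟨ eval-⊕ (monomial (a fzero) (E fzero)) _ x ⟩
    eval (monomial (a fzero) (E fzero)) x + eval (sparse (a ∘ fsuc) (E ∘ fsuc)) x
      ≈⟨ +-cong (eval-monomial (a fzero) (E fzero) x) (eval-sparse (a ∘ fsuc) (E ∘ fsuc) x) ⟩
    a · (λ i → x ^ E i) ∎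

  length-sparse : ∀ {k} (a : Fin k → Carrier) E {n} → (∀ i → E i < n) → length (sparse a E) ≤ n
  length-sparse {zero}  a E E<n = z≤n
  length-sparse {suc k} a E E<n = length-⊕ (monomial (a fzero) (E fzero)) _
    (≡.subst (_≤ _) (≡.sym (length-monomial (a fzero) (E fzero))) (E<n fzero))
    (length-sparse (a ∘ fsuc) (E ∘ fsuc) (E<n ∘ fsuc))

  coeff-sparse-other : ∀ {k} (a : Fin k → Carrier) E j → (∀ i → ¬ j ≡.≡ E i) → coeff (sparse a E) j ≈ 0#
  coeff-sparse-other {zero}  a E j j∉E = refl
  coeff-sparse-other {suc k} a E j j∉E = begin
    coeff (monomial (a fzero) (E fzero) ⊕ sparse (a ∘ fsuc) (E ∘ fsuc)) j
      ≈⟨ coeff-⊕ (monomial (a fzero) (E fzero)) _ j ⟩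
    coeff (monomial (a fzero) (E fzero)) j + coeff (sparse (a ∘ fsuc) (E ∘ fsuc)) j
      ≈⟨ +-cong (coeff-monomial-other (a fzero) (E fzero) j (j∉E fzero))
                (coeff-sparse-other (a ∘ fsuc) (E ∘ fsuc) j (j∉E ∘ fsuc)) ⟩
    0# + 0#
      ≈⟨ +-identityˡ 0# ⟩
    0# ∎

  coeff-sparse-exponent : ∀ {k} (a : Fin k → Carrier) E → (∀ i j → E i ≡.≡ E j → i ≡.≡ j) →
                          ∀ j → coeff (sparse a E) (E j) ≈ a j
  coeff-sparse-exponent {suc k} a E E-inj fzero = begin
    coeff (monomial (a fzero) (E fzero) ⊕ sparse (a ∘ fsuc) (E ∘ fsuc)) (E fzero)
      ≈⟨ coeff-⊕ (monomial (a fzero) (E fzero)) _ (E fzero) ⟩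
    coeff (monomial (a fzero) (E fzero)) (E fzero) + coeff (sparse (a ∘ fsuc) (E ∘ fsuc)) (E fzero)
      ≈⟨ +-cong (coeff-monomial-same (a fzero) (E fzero))
                (coeff-sparse-other (a ∘ fsuc) (E ∘ fsuc) (E fzero) (λ i e → FinP.0≢1+n (E-inj fzero (fsuc i) e))) ⟩
    a fzero + 0#
      ≈⟨ +-identityʳ _ ⟩
    a fzero ∎
  coeff-sparse-exponent {suc k} a E E-inj (fsuc j) = begin
    coeff (monomial (a fzero) (E fzero) ⊕ sparse (a ∘ fsuc) (E ∘ fsuc)) (E (fsuc j))
      ≈⟨ coeff-⊕ (monomial (a fzero) (E fzero)) _ (E (fsuc j)) ⟩
    coeff (monomial (a fzero) (E fzero)) (E (fsuc j)) + coeff (sparse (a ∘ fsuc) (E ∘ fsuc)) (E (fsuc j))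
      ≈⟨ +-cong (coeff-monomial-other (a fzero) (E fzero) (E (fsuc j)) (λ e → FinP.0≢1+n (≡.sym (E-inj (fsuc j) fzero e))))
                (coeff-sparse-exponent (a ∘ fsuc) (E ∘ fsuc) (λ i i' e → FinP.suc-injective (E-inj (fsuc i) (fsuc i') e)) j) ⟩
    0# + a (fsuc j)
      ≈⟨ +-identityˡ _ ⟩
    a (fsuc j) ∎

module GaussianElimination {c ℓ} (F : Field c ℓ) {n : ℕ} (_≟0 : ∀ x → Dec (Field._≈_ F x (Field.0# F))) where
  open FieldProperties F
  open Vectors F

  Vector : ℕ → Set c
  Vector k = Fin k → Carrier

  Family : ℕ → Set c
  Family k = Fin n → Vector k

  combination : ∀ {k} → Family k → List (Fin n × Carrier) → Vector k
  combination v []             i = 0#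
  combination v ((t , y) ∷ ps) i = y * v t i + combination v ps i

  Spans : ∀ k → Family k → Set (c ⊔ ℓ)
  Spans k v = ∀ (w : Vector k) → Σ (List (Fin n × Carrier)) λ ps →
    length ps ≤ k × (∀ i → combination v ps i ≈ w i)

  SpansWithPivot : ∀ k → Family (suc k) → Fin n → Set (c ⊔ ℓ)
  SpansWithPivot k v t₀ = ∀ (w : Vector (suc k)) → Σ Carrier λ y₀ → Σ (List (Fin n × Carrier)) λ ps →
    length ps ≤ k × (∀ i → combination v ((t₀ , y₀) ∷ ps) i ≈ w i)

  Annihilated : ∀ k → Family k → Set (c ⊔ ℓ)
  Annihilated k v = Σ (Vector k) λ a → (Σ (Fin k) λ i → ¬ a i ≈ 0#) × (∀ t → a · v t ≈ 0#)

  module Pivot {k} (v : Family (suc k)) (t₀ : Fin n) (v₀≉0 : ¬ v t₀ fzero ≈ 0#) where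
    π π⁻¹ : Carrier
    π = v t₀ fzero
    π⁻¹ = proj₁ (inverse π v₀≉0)
    ππ⁻¹≈1 : π * π⁻¹ ≈ 1#
    ππ⁻¹≈1 = proj₂ (inverse π v₀≉0)

    reduced : Family k
    reduced t i = v t (fsuc i) - (v t fzero * π⁻¹) * v t₀ (fsuc i)

    combination-reduced : ∀ ps i → combination reduced ps i ≈
      combination v ps (fsuc i) - (combination v ps fzero * π⁻¹) * v t₀ (fsuc i)
    combination-reduced [] i =
      solve 2 (λ ι c → con (ℤ.+ 0) := con (ℤ.+ 0) :- (con (ℤ.+ 0) :* ι) :* c) refl π⁻¹ (v t₀ (fsuc i))
    combination-reduced ((t , y) ∷ ps) i = begin
      y * reduced t i + combination reduced ps i
        ≈⟨ +-congˡ (combination-reduced ps i) ⟩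
      y * (v t (fsuc i) - (v t fzero * π⁻¹) * v t₀ (fsuc i)) + (C (fsuc i) - (C fzero * π⁻¹) * v t₀ (fsuc i))
        ≈⟨ solve 7 (λ y a b ι c L B → y :* (a :- (b :* ι) :* c) :+ (L :- (B :* ι) :* c)
                                   := (y :* a :+ L) :- ((y :* b :+ B) :* ι) :* c)
             refl y (v t (fsuc i)) (v t fzero) π⁻¹ (v t₀ (fsuc i)) (C (fsuc i)) (C fzero) ⟩
      (y * v t (fsuc i) + C (fsuc i)) - ((y * v t fzero + C fzero) * π⁻¹) * v t₀ (fsuc i) ∎
      where C = combination v ps

    spansWithPivot : Spans k reduced → SpansWithPivot k v t₀
    spansWithPivot spans w with spans (λ i → w (fsuc i) - (w fzero * π⁻¹) * v t₀ (fsuc i))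
    ... | ps , |ps|≤k , ps-spans = (α - β) , ps , |ps|≤k , reconstructs
      where
      α = w fzero * π⁻¹
      C = combination v ps
      β = C fzero * π⁻¹
      reconstructs : ∀ i → combination v ((t₀ , α - β) ∷ ps) i ≈ w i
      reconstructs fzero = begin
        (α - β) * π + C fzero
          ≈⟨ solve 4 (λ w L ι π → (w :* ι :- L :* ι) :* π :+ L
                               := w :* (π :* ι) :+ L :* (con (ℤ.+ 1) :- π :* ι))
               refl (w fzero) (C fzero) π⁻¹ π ⟩
        w fzero * (π * π⁻¹) + C fzero * (1# - π * π⁻¹)
          ≈⟨ +-cong (*-congˡ ππ⁻¹≈1) (*-congˡ (+-congˡ (-‿cong ππ⁻¹≈1))) ⟩
        w fzero * 1# + C fzero * (1# - 1#)
          ≈⟨ solve 2 (λ w L → w :* con (ℤ.+ 1) :+ L :* (con (ℤ.+ 1) :- con (ℤ.+ 1)) := w) refl (w fzero) (C fzero) ⟩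
        w fzero ∎
      reconstructs (fsuc i) = begin
        (α - β) * v t₀ (fsuc i) + C (fsuc i)
          ≈⟨ solve 4 (λ α B c L → (α :- B) :* c :+ L := (L :- B :* c) :+ α :* c)
               refl α β (v t₀ (fsuc i)) (C (fsuc i)) ⟩
        (C (fsuc i) - β * v t₀ (fsuc i)) + α * v t₀ (fsuc i)
          ≈⟨ +-congʳ (combination-reduced ps i) ⟨
        combination reduced ps i + α * v t₀ (fsuc i)
          ≈⟨ +-congʳ (ps-spans i) ⟩
        (w (fsuc i) - α * v t₀ (fsuc i)) + α * v t₀ (fsuc i)
          ≈⟨ solve 2 (λ w X → (w :- X) :+ X := w) refl (w (fsuc i)) (α * v t₀ (fsuc i)) ⟩
        w (fsuc i) ∎

    liftAnnihilator : Annihilated k reduced → Annihilated (suc k) v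
    liftAnnihilator (a , (j , aⱼ≉0) , a·reduced≈0) = a' , (fsuc j , aⱼ≉0) , a'·v≈0
      where
      D = a · (v t₀ ∘ fsuc)
      a' : Vector (suc k)
      a' fzero    = - (D * π⁻¹)
      a' (fsuc i) = a i
      a'·v≈0 : ∀ t → a' · v t ≈ 0#
      a'·v≈0 t = begin
        - (D * π⁻¹) * v t fzero + a · (v t ∘ fsuc)
          ≈⟨ solve 4 (λ D ι b X → (:- (D :* ι)) :* b :+ X := X :- (b :* ι) :* D)
               refl D π⁻¹ (v t fzero) (a · (v t ∘ fsuc)) ⟩
        a · (v t ∘ fsuc) - (v t fzero * π⁻¹) * D
          ≈⟨ a·[b-sd]≈a·b-s[a·d] a (v t ∘ fsuc) (v t₀ ∘ fsuc) (v t fzero * π⁻¹) ⟨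
        a · reduced t
          ≈⟨ a·reduced≈0 t ⟩
        0# ∎

  spans-or-annihilated : ∀ k (v : Family k) → Spans k v ⊎ Annihilated k v
  spans-or-annihilated zero    v = inj₁ (λ w → [] , z≤n , λ ())
  spans-or-annihilated (suc k) v with FinP.all? (λ t → v t fzero ≟0)
  ... | yes v₀≈0 = inj₂ (e₀ , (fzero , 1≉0) , e₀·v≈0)
    where
    e₀ : Vector (suc k)
    e₀ fzero    = 1#
    e₀ (fsuc i) = 0#
    e₀·v≈0 : ∀ t → e₀ · v t ≈ 0#
    e₀·v≈0 t = begin
      1# * v t fzero + (λ _ → 0#) · (v t ∘ fsuc)  ≈⟨ +-cong (trans (*-identityˡ _) (v₀≈0 t)) (0·b≈0 (v t ∘ fsuc)) ⟩
      0# + 0#                                     ≈⟨ +-identityˡ 0# ⟩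
      0#                                          ∎
  ... | no ¬v₀≈0 with FinP.¬∀⟶∃¬ n (λ t → v t fzero ≈ 0#) (λ t → v t fzero ≟0) ¬v₀≈0
  ...   | t₀ , v₀≉0 with spans-or-annihilated k (Pivot.reduced v t₀ v₀≉0)
  ...     | inj₂ annihilated = inj₂ (Pivot.liftAnnihilator v t₀ v₀≉0 annihilated)
  ...     | inj₁ spans = inj₁ λ w →
    let y₀ , ps , |ps|≤k , reconstructs = Pivot.spansWithPivot v t₀ v₀≉0 spans w
    in (t₀ , y₀) ∷ ps , s≤s |ps|≤k , reconstructs

module Moore {c ℓ} (F : Field c ℓ) {p : ℕ} (p-prime : Prime p)
             (p≈0 : Field._≈_ F (FieldProperties.ofℕ F p) (Field.0# F)) where
  open FieldProperties F
  open Frobenius F p-prime p≈0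
  open import Algebra.Properties.Semiring.Exp semiring using (_^_)

  frobeniusSum : List (Carrier × Carrier) → ℕ → Carrier
  frobeniusSum []             k = 0#
  frobeniusSum ((t , y) ∷ ps) k = y * φ k t + frobeniusSum ps k

  module _ (c : Carrier) where
    γ : Carrier
    γ = c ^ ℕ.pred p

    -- twist is additive, kills c, and φₖ ∘ twist = φₖ₊₁ - φₖ(γ) φₖ; twisting by
    -- the first tⱼ therefore shortens the sum and drives the induction below.
    twist : Carrier → Carrier
    twist t = t ^ p - γ * t

    twist-self : twist c ≈ 0#
    twist-self = begin
      c ^ p - γ * c        ≈⟨ +-congʳ cᵖ≈c*γ ⟩
      c * γ - γ * c        ≈⟨ solve 2 (λ c γ → c :* γ :- γ :* c := con (ℤ.+ 0)) refl c γ ⟩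
      0#                   ∎
      where
      cᵖ≈c*γ : c ^ p ≈ c * γ
      cᵖ≈c*γ = ≡.subst (λ n → c ^ n ≈ c * γ) (ℕP.suc-pred p {{prime⇒nonZero p-prime}}) refl

    twisted : List (Carrier × Carrier) → List (Carrier × Carrier)
    twisted = map λ (t , y) → twist t , y

    frobeniusSum-twisted : ∀ ps k → frobeniusSum (twisted ps) k ≈ frobeniusSum ps (suc k) - φ k γ * frobeniusSum ps k
    frobeniusSum-twisted []             k = solve 1 (λ g → con (ℤ.+ 0) := con (ℤ.+ 0) :- g :* con (ℤ.+ 0)) refl (φ k γ)
    frobeniusSum-twisted ((t , y) ∷ ps) k = begin
      y * φ k (twist t) + frobeniusSum (twisted ps) k
        ≈⟨ +-cong (*-congˡ φ-twist) (frobeniusSum-twisted ps k) ⟩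
      y * (φ (suc k) t - φ k γ * φ k t) + (frobeniusSum ps (suc k) - φ k γ * frobeniusSum ps k)
        ≈⟨ solve 6 (λ y A g B X Y → y :* (A :- g :* B) :+ (X :- g :* Y) := (y :* A :+ X) :- g :* (y :* B :+ Y))
             refl y (φ (suc k) t) (φ k γ) (φ k t) (frobeniusSum ps (suc k)) (frobeniusSum ps k) ⟩
      (y * φ (suc k) t + frobeniusSum ps (suc k)) - φ k γ * (y * φ k t + frobeniusSum ps k) ∎
      where
      φ-twist : φ k (twist t) ≈ φ (suc k) t - φ k γ * φ k t
      φ-twist = begin
        φ k (t ^ p - γ * t)           ≈⟨ φ-- k (t ^ p) (γ * t) ⟩
        φ k (t ^ p) - φ k (γ * t)     ≈⟨ +-cong (φ-suc k t) (-‿cong (sym (φ-* k γ t))) ⟨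
        φ (suc k) t - φ k γ * φ k t   ∎

    frobeniusSum-twisted-self : ∀ y ps k → frobeniusSum (twisted ((c , y) ∷ ps)) k ≈ frobeniusSum (twisted ps) k
    frobeniusSum-twisted-self y ps k = begin
      y * φ k (twist c) + frobeniusSum (twisted ps) k   ≈⟨ +-congʳ (*-congˡ (trans (φ-cong k twist-self) (φ-0 k))) ⟩
      y * 0# + frobeniusSum (twisted ps) k              ≈⟨ solve 2 (λ y S → y :* con (ℤ.+ 0) :+ S := S) refl y _ ⟩
      frobeniusSum (twisted ps) k                       ∎

  frobeniusSum-vanishes : ∀ n ps → length ps ≤ n → (∀ k → k < n → frobeniusSum ps k ≈ 0#) →
                          frobeniusSum ps n ≈ 0#
  frobeniusSum-vanishes n       []       _ _ = refl
  frobeniusSum-vanishes (suc n) qs@((c , y) ∷ ps) (s≤s |ps|≤n) vanish = begin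
    frobeniusSum qs (suc n)                                   ≈⟨ shift n ⟨
    frobeniusSum (twisted c ps) n + φ n (γ c) * frobeniusSum qs n
      ≈⟨ +-cong (frobeniusSum-vanishes n (twisted c ps) |twisted|≤n twisted-vanish) (*-congˡ (vanish n (ℕP.n<1+n n))) ⟩
    0# + φ n (γ c) * 0#                                       ≈⟨ solve 1 (λ g → con (ℤ.+ 0) :+ g :* con (ℤ.+ 0) := con (ℤ.+ 0)) refl _ ⟩
    0#                                                        ∎
    where
    |twisted|≤n : length (twisted c ps) ≤ n
    |twisted|≤n = ≡.subst (_≤ n) (≡.sym (ListP.length-map _ ps)) |ps|≤n
    shift : ∀ k → frobeniusSum (twisted c ps) k + φ k (γ c) * frobeniusSum qs k ≈ frobeniusSum qs (suc k)
    shift k = begin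
      frobeniusSum (twisted c ps) k + φ k (γ c) * frobeniusSum qs k
        ≈⟨ +-congʳ (trans (sym (frobeniusSum-twisted-self c y ps k)) (frobeniusSum-twisted c qs k)) ⟩
      (frobeniusSum qs (suc k) - φ k (γ c) * frobeniusSum qs k) + φ k (γ c) * frobeniusSum qs k
        ≈⟨ solve 2 (λ A B → (A :- B) :+ B := A) refl _ _ ⟩
      frobeniusSum qs (suc k) ∎
    twisted-vanish : ∀ k → k < n → frobeniusSum (twisted c ps) k ≈ 0#
    twisted-vanish k k<n = begin
      frobeniusSum (twisted c ps) k                              ≈⟨ frobeniusSum-twisted-self c y ps k ⟨
      frobeniusSum (twisted c qs) k                              ≈⟨ frobeniusSum-twisted c qs k ⟩
      frobeniusSum qs (suc k) - φ k (γ c) * frobeniusSum qs k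
        ≈⟨ +-cong (vanish (suc k) (s≤s k<n)) (-‿cong (*-congˡ (vanish k (ℕP.<-trans k<n (ℕP.n<1+n n))))) ⟩
      0# - φ k (γ c) * 0#                                        ≈⟨ solve 1 (λ g → con (ℤ.+ 0) :- g :* con (ℤ.+ 0) := con (ℤ.+ 0)) refl _ ⟩
      0#                                                         ∎

module Geometry {c ℓ} (F : Field c ℓ) (p m : ℕ) where
  open FieldProperties F
  open LGraph F p m
  open import Algebra.Properties.Semiring.Exp semiring using (_^_)

  pow≈^ : ∀ x n → pow x n ≈ x ^ n
  pow≈^ x zero    = refl
  pow≈^ x (suc n) = *-congˡ (pow≈^ x n)

  ψ : Fin m → Carrier → Carrier
  ψ i a = pow a (p ℕ.^ toℕ i)

  pow-cong : ∀ n {x y} → x ≈ y → pow x n ≈ pow y n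
  pow-cong zero    x≈y = refl
  pow-cong (suc n) x≈y = *-cong x≈y (pow-cong n x≈y)

  ψ-cong : ∀ i {a b} → a ≈ b → ψ i a ≈ ψ i b
  ψ-cong i = pow-cong (p ℕ.^ toℕ i)

  lineThrough : Coord → Carrier → Coord
  lineThrough P x = x ◂ λ i → ψ i (head P) * x - tail P i

  pointOn : Coord → Carrier → Coord
  pointOn L t = t ◂ λ i → ψ i t * head L - tail L i

  incident-lineThrough : ∀ P x → Incident P (lineThrough P x)
  incident-lineThrough P x i = solve 3 (λ A x u → (A :* x :- u) :+ u := A :* x) refl (ψ i (head P)) x (tail P i)

  incident-pointOn : ∀ L t → Incident (pointOn L t) L
  incident-pointOn L t i = solve 3 (λ T x l → l :+ (T :* x :- l) := T :* x) refl (ψ i t) (head L) (tail L i)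

  stepToLine : ∀ {n P v} L → Incident P L → Walk n (inj₂ L) v → Walk (suc n) (inj₁ P) v
  stepToLine L P∈L walk = P∈L ∷ walk

  stepToPoint : ∀ {n L v} P → Incident P L → Walk n (inj₁ P) v → Walk (suc n) (inj₂ L) v
  stepToPoint P P∈L walk = P∈L ∷ walk

  common-line : ∀ P P' L → Incident P L → Incident P' L →
                ∀ i → tail P' i ≈ tail P i + head L * (ψ i (head P') - ψ i (head P))
  common-line P P' L P∈L P'∈L i = begin
    tail P' i
      ≈⟨ solve 3 (λ P' l P → P' := (l :+ P') :- (l :+ P) :+ P) refl (tail P' i) (tail L i) (tail P i) ⟩
    (tail L i + tail P' i) - (tail L i + tail P i) + tail P i
      ≈⟨ +-congʳ (+-cong (P'∈L i) (-‿cong (P∈L i))) ⟩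
    ψ i (head P') * head L - ψ i (head P) * head L + tail P i
      ≈⟨ solve 4 (λ A B x P → A :* x :- B :* x :+ P := P :+ x :* (A :- B))
           refl (ψ i (head P')) (ψ i (head P)) (head L) (tail P i) ⟩
    tail P i + head L * (ψ i (head P') - ψ i (head P)) ∎

  drift : List (Carrier × Carrier) → Carrier → Fin m → Carrier
  drift []             b i = 0#
  drift ((t , y) ∷ ps) b i = y * (ψ i t - ψ i b) + drift ps b i

  -- For ps = [(t₁, y₁), …, (tₙ, yₙ)], PointsJoined ps z P Q describes the walks
  -- P, L₀, P₁, L₁, …, Pₙ, Lₙ, Q with head Pⱼ = tⱼ and head Lⱼ = z - y₁ - … - yⱼ;
  -- LinesJoined ps s L L' the walks L, P₁, L₁, …, Pₙ, Lₙ, P, L' with head Pⱼ = tⱼ,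
  -- head Lⱼ = head L + y₁ + … + yⱼ and head P = s.
  PointsJoined : List (Carrier × Carrier) → Carrier → Coord → Coord → Set ℓ
  PointsJoined ps z P Q = ∀ i → tail Q i ≈ tail P i + z * (ψ i (head Q) - ψ i (head P)) + drift ps (head Q) i

  LinesJoined : List (Carrier × Carrier) → Carrier → Coord → Coord → Set ℓ
  LinesJoined ps s L L' = ∀ i → tail L' i ≈ tail L i + drift ps s i + (head L' - head L) * ψ i s

  pointsJoined⇒walk : ∀ ps z P Q → PointsJoined ps z P Q → Walk (suc (length ps) ℕ.* 2) (inj₁ P) (inj₁ Q)
  pointsJoined⇒walk [] z P Q joined =
    stepToLine (lineThrough P z) (incident-lineThrough P z) (stepToPoint Q Q∈L ([] (λ _ → refl)))
    where
    Q∈L : Incident Q (lineThrough P z)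
    Q∈L i = begin
      (ψ i (head P) * z - tail P i) + tail Q i
        ≈⟨ +-congˡ (joined i) ⟩
      (ψ i (head P) * z - tail P i) + (tail P i + z * (ψ i (head Q) - ψ i (head P)) + 0#)
        ≈⟨ solve 4 (λ A B z u → (A :* z :- u) :+ (u :+ z :* (B :- A) :+ con (ℤ.+ 0)) := B :* z)
             refl (ψ i (head P)) (ψ i (head Q)) z (tail P i) ⟩
      ψ i (head Q) * z ∎
  pointsJoined⇒walk ((t , y) ∷ ps) z P Q joined =
    stepToLine L (incident-lineThrough P z) (stepToPoint P' (incident-pointOn L t) (pointsJoined⇒walk ps (z - y) P' Q joined′))
    where
    L = lineThrough P z
    P' = pointOn L t
    joined′ : PointsJoined ps (z - y) P' Q
    joined′ i = trans (joined i) (solve 7 (λ A B T z y u R →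
        u :+ z :* (B :- A) :+ (y :* (T :- B) :+ R)
     := (T :* z :- (A :* z :- u)) :+ (z :- y) :* (B :- T) :+ R)
      refl (ψ i (head P)) (ψ i (head Q)) (ψ i t) z y (tail P i) (drift ps (head Q) i))

  linesJoined⇒walk : ∀ ps s L L' → LinesJoined ps s L L' → Walk (suc (length ps) ℕ.* 2) (inj₂ L) (inj₂ L')
  linesJoined⇒walk [] s L L' joined =
    stepToPoint (pointOn L s) (incident-pointOn L s) (stepToLine L' P∈L' ([] (λ _ → refl)))
    where
    P∈L' : Incident (pointOn L s) L'
    P∈L' i = begin
      tail L' i + (ψ i s * head L - tail L i)
        ≈⟨ +-congʳ (joined i) ⟩
      (tail L i + 0# + (head L' - head L) * ψ i s) + (ψ i s * head L - tail L i)
        ≈⟨ solve 4 (λ S x x' l → (l :+ con (ℤ.+ 0) :+ (x' :- x) :* S) :+ (S :* x :- l) := S :* x')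
             refl (ψ i s) (head L) (head L') (tail L i) ⟩
      ψ i s * head L' ∎
  linesJoined⇒walk ((t , y) ∷ ps) s L L' joined =
    stepToPoint P (incident-pointOn L t) (stepToLine L₁ P∈L₁ (linesJoined⇒walk ps s L₁ L' joined′))
    where
    P = pointOn L t
    L₁ = lineThrough P (head L + y)
    P∈L₁ : Incident P L₁
    P∈L₁ = incident-lineThrough P (head L + y)
    joined′ : LinesJoined ps s L₁ L'
    joined′ i = trans (joined i) (solve 7 (λ T S x y x' l R →
        l :+ (y :* (T :- S) :+ R) :+ (x' :- x) :* S
     := (T :* (x :+ y) :- (T :* x :- l)) :+ R :+ (x' :- (x :+ y)) :* S)
      refl (ψ i t) (ψ i s) (head L) y (head L') (tail L i) (drift ps s i))

  walk⇒pointsJoined : ∀ {n} P Q → Walk n (inj₁ P) (inj₁ Q) →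
    (n ≡.≡ 0 × inj₁ P ≈ᵥ inj₁ Q) ⊎
    Σ (List (Carrier × Carrier)) λ ps → Σ Carrier λ z → n ≡.≡ suc (length ps) ℕ.* 2 × PointsJoined ps z P Q
  walk⇒pointsJoined P Q ([] P≈Q) = inj₁ (≡.refl , P≈Q)
  walk⇒pointsJoined P Q (_∷_ {w = inj₁ _} () _)
  walk⇒pointsJoined P Q (_∷_ {w = inj₂ L} _ ([] ()))
  walk⇒pointsJoined P Q (_∷_ {w = inj₂ L} _ (_∷_ {w = inj₂ _} () _))
  walk⇒pointsJoined P Q (_∷_ {w = inj₂ L} P∈L (_∷_ {w = inj₁ P'} P'∈L rest)) with walk⇒pointsJoined P' Q rest
  ... | inj₁ (≡.refl , P'≈Q) = inj₂ ([] , head L , ≡.refl , joined)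
    where
    joined : PointsJoined [] (head L) P Q
    joined i = begin
      tail Q i                                                ≈⟨ P'≈Q (fsuc i) ⟨
      tail P' i                                               ≈⟨ common-line P P' L P∈L P'∈L i ⟩
      tail P i + head L * (ψ i (head P') - ψ i (head P))      ≈⟨ +-congˡ (*-congˡ (+-congʳ (ψ-cong i (P'≈Q fzero)))) ⟩
      tail P i + head L * (ψ i (head Q) - ψ i (head P))       ≈⟨ +-identityʳ _ ⟨
      tail P i + head L * (ψ i (head Q) - ψ i (head P)) + 0# ∎
  ... | inj₂ (ps , z , ≡.refl , joined′) = inj₂ ((head P' , head L - z) ∷ ps , head L , ≡.refl , joined)
    where
    joined : PointsJoined ((head P' , head L - z) ∷ ps) (head L) P Q
    joined i = begin
      tail Q i
        ≈⟨ joined′ i ⟩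
      tail P' i + z * (ψ i (head Q) - ψ i (head P')) + drift ps (head Q) i
        ≈⟨ +-congʳ (+-congʳ (common-line P P' L P∈L P'∈L i)) ⟩
      tail P i + head L * (ψ i (head P') - ψ i (head P)) + z * (ψ i (head Q) - ψ i (head P')) + drift ps (head Q) i
        ≈⟨ solve 7 (λ u x A' A z B R → u :+ x :* (A' :- A) :+ z :* (B :- A') :+ R
                                     := u :+ x :* (B :- A) :+ ((x :- z) :* (A' :- B) :+ R))
             refl (tail P i) (head L) (ψ i (head P')) (ψ i (head P)) z (ψ i (head Q)) (drift ps (head Q) i) ⟩
      tail P i + head L * (ψ i (head Q) - ψ i (head P)) + ((head L - z) * (ψ i (head P') - ψ i (head Q)) + drift ps (head Q) i) ∎

2*[n+1]≡[1+n]*2 : ∀ n → 2 ℕ.* (n ℕ.+ 1) ≡.≡ suc n ℕ.* 2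
2*[n+1]≡[1+n]*2 n = ≡.trans (ℕP.*-comm 2 (n ℕ.+ 1)) (≡.cong (ℕ._* 2) (ℕP.+-comm n 1))

module UpperBound {c ℓ} (F : Field c ℓ) {p q e : ℕ} (k : ℕ) (F↔Fin : HasOrder F q)
                  (1<p : 1 < p) (q≡pᵉ : q ≡.≡ p ℕ.^ e) (m≤e : suc k ≤ e) where
  open FieldProperties F
  open Vectors F
  open Polynomials F
  open FiniteField F F↔Fin
  open GaussianElimination F {q} _≟0
  open LGraph F p (suc k)
  open Geometry F p (suc k)
  open import Algebra.Properties.Semiring.Exp semiring using (_^_)

  m : ℕ
  m = suc k

  diam : ℕ
  diam = 2 ℕ.* (m ℕ.+ 1)

  exponent : Fin m → ℕ
  exponent i = p ℕ.^ toℕ i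

  exponent<q : ∀ i → exponent i < q
  exponent<q i = ≡.subst (exponent i <_) (≡.sym q≡pᵉ) (ℕP.^-monoʳ-< p 1<p (ℕP.<-≤-trans (FinP.toℕ<n i) m≤e))

  exponent≢0 : ∀ i → ¬ exponent i ≡.≡ 0
  exponent≢0 i pⁱ≡0 with ℕP.m^n≡0⇒m≡0 p (toℕ i) pⁱ≡0
  ... | ≡.refl = ℕP.<-irrefl ≡.refl (ℕP.<-trans (s≤s z≤n) 1<p)

  differences : Carrier → Family m
  differences b t i = ψ i (element t) - ψ i b

  -- P below has degree p^(m-1) < q but vanishes on all q elements of F.
  differences-not-annihilated : ∀ b → ¬ Annihilated m (differences b)
  differences-not-annihilated b (a , (j , aⱼ≉0) , a·differences≈0) = aⱼ≉0 (begin
    a j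
      ≈⟨ +-identityˡ _ ⟨
    0# + a j
      ≈⟨ +-cong (coeff-monomial-other (- K) 0 (exponent j) (exponent≢0 j))
                (coeff-sparse-exponent a exponent exponent-injective j) ⟨
    coeff (monomial (- K) 0) (exponent j) + coeff (sparse a exponent) (exponent j)
      ≈⟨ coeff-⊕ (monomial (- K) 0) (sparse a exponent) (exponent j) ⟨
    coeff P (exponent j)
      ≈⟨ coeff-zero P (exponent j) P≈0 ⟩
    0# ∎)
    where
    K = a · (λ i → b ^ exponent i)
    P = monomial (- K) 0 ⊕ sparse a exponent
    exponent-injective : ∀ i j → exponent i ≡.≡ exponent j → i ≡.≡ j
    exponent-injective i j pⁱ≡pʲ = FinP.toℕ-injective (^-injectiveʳ 1<p (toℕ i) (toℕ j) pⁱ≡pʲ)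
    |P|≤q : length P ≤ length (tabulate element)
    |P|≤q = ≡.subst (length P ≤_) (≡.sym (ListP.length-tabulate element))
      (length-⊕ (monomial (- K) 0) (sparse a exponent) (ℕP.<⇒≤ (exponent<q fzero)) (length-sparse a exponent exponent<q))
    root : ∀ t → eval P (element t) ≈ 0#
    root t = begin
      eval P x
        ≈⟨ eval-⊕ (monomial (- K) 0) (sparse a exponent) x ⟩
      eval (monomial (- K) 0) x + eval (sparse a exponent) x
        ≈⟨ +-cong (eval-monomial (- K) 0 x) (eval-sparse a exponent x) ⟩
      - K * 1# + a · (λ i → x ^ exponent i)
        ≈⟨ solve 2 (λ K X → :- K :* con (ℤ.+ 1) :+ X := X :- K) refl K _ ⟩
      a · (λ i → x ^ exponent i) - K
        ≈⟨ a·[b-d]≈a·b-a·d a (λ i → x ^ exponent i) (λ i → b ^ exponent i) ⟨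
      a · (λ i → x ^ exponent i - b ^ exponent i)
        ≈⟨ ·-congˡ a (λ i → +-cong (pow≈^ x (exponent i)) (-‿cong (pow≈^ b (exponent i)))) ⟨
      a · differences b t
        ≈⟨ a·differences≈0 t ⟩
      0# ∎
      where x = element t
    P≈0 : IsZero P
    P≈0 = length≤#roots⇒zero (tabulate element) P |P|≤q
      (AllPairsP.tabulate⁺ (λ i≢j eq → i≢j (element-injective eq))) (AllP.tabulate⁺ root)

  spans : ∀ b → Spans m (differences b)
  spans b with spans-or-annihilated m (differences b)
  ... | inj₁ spanning    = spanning
  ... | inj₂ annihilated = ⊥-elim (differences-not-annihilated b annihilated)

  spansWithPivot : ∀ b t₀ → ¬ element t₀ ≈ b → SpansWithPivot k (differences b) t₀
  spansWithPivot b t₀ t₀≉b with spans-or-annihilated k (Pivot.reduced (differences b) t₀ pivot≉0)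
    where
    pivot≉0 : ¬ differences b t₀ fzero ≈ 0#
    pivot≉0 d≈0 = t₀≉b (x-y≈0⇒x≈y (trans (sym (+-cong (*-identityʳ _) (-‿cong (*-identityʳ _)))) d≈0))
  ... | inj₁ spanning    = Pivot.spansWithPivot (differences b) t₀ _ spanning
  ... | inj₂ annihilated = ⊥-elim (differences-not-annihilated b (Pivot.liftAnnihilator (differences b) t₀ _ annihilated))

  fieldPairs : List (Fin q × Carrier) → List (Carrier × Carrier)
  fieldPairs = map (map₁ element)

  combination≈drift : ∀ b ps i → combination (differences b) ps i ≈ drift (fieldPairs ps) b i
  combination≈drift b []             i = refl
  combination≈drift b ((t , y) ∷ ps) i = +-congˡ (combination≈drift b ps i)

  another : ∀ a → Σ Carrier λ s → ¬ s ≈ a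
  another a with a ≟0
  ... | yes a≈0 = 1# , λ 1≈a → 1≉0 (trans 1≈a a≈0)
  ... | no  a≉0 = 0# , λ 0≈a → a≉0 (sym 0≈a)

  length-fieldPairs : ∀ ps → length (fieldPairs ps) ≡.≡ length ps
  length-fieldPairs = ListP.length-map _

  even-length-bound : ∀ {n} → n ≤ m → suc n ℕ.* 2 ≤ diam
  even-length-bound {n} n≤m = ≡.subst (suc n ℕ.* 2 ≤_) (≡.sym (2*[n+1]≡[1+n]*2 m)) (ℕP.*-monoˡ-≤ 2 (s≤s n≤m))

  odd-length-bound : ∀ {n} → n ≤ k → suc (suc n ℕ.* 2) ≤ diam
  odd-length-bound n≤k = ℕP.≤-trans (ℕP.n≤1+n _) (even-length-bound (s≤s n≤k))

  pivot-remainder : ∀ {b t₀ a} → element t₀ ≈ a → ∀ y₀ ps i {wᵢ} →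
                    combination (differences b) ((t₀ , y₀) ∷ ps) i ≈ wᵢ →
                    wᵢ - y₀ * (ψ i a - ψ i b) ≈ drift (fieldPairs ps) b i
  pivot-remainder {b} {t₀} {a} t₀≈a y₀ ps i {wᵢ} reconstructs = begin
    wᵢ - y₀ * (ψ i a - ψ i b)
      ≈⟨ +-congʳ reconstructs ⟨
    (y₀ * (ψ i (element t₀) - ψ i b) + combination (differences b) ps i) - y₀ * (ψ i a - ψ i b)
      ≈⟨ +-cong (+-cong (*-congˡ (+-congʳ (ψ-cong i t₀≈a))) (combination≈drift b ps i)) refl ⟩
    (y₀ * (ψ i a - ψ i b) + drift (fieldPairs ps) b i) - y₀ * (ψ i a - ψ i b)
      ≈⟨ solve 2 (λ X Y → (X :+ Y) :- X := Y) refl _ _ ⟩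
    drift (fieldPairs ps) b i ∎

  points-close : ∀ P Q → ∃ λ n → n ≤ diam × Walk n (inj₁ P) (inj₁ Q)
  points-close P Q with spans (head Q) (λ i → tail Q i - tail P i)
  ... | ps , |ps|≤m , reconstructs =
    _ , even-length-bound (≡.subst (_≤ m) (≡.sym (length-fieldPairs ps)) |ps|≤m) ,
    pointsJoined⇒walk (fieldPairs ps) 0# P Q joined
    where
    joined : PointsJoined (fieldPairs ps) 0# P Q
    joined i = begin
      tail Q i
        ≈⟨ solve 2 (λ Q P → Q := P :+ con (ℤ.+ 0) :+ (Q :- P)) refl (tail Q i) (tail P i) ⟩
      tail P i + 0# + (tail Q i - tail P i)
        ≈⟨ +-cong (+-congˡ (sym (zeroˡ _))) (trans (sym (reconstructs i)) (combination≈drift (head Q) ps i)) ⟩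
      tail P i + 0# * (ψ i (head Q) - ψ i (head P)) + drift (fieldPairs ps) (head Q) i ∎

  lines-close : ∀ L L' → ∃ λ n → n ≤ diam × Walk n (inj₂ L) (inj₂ L')
  lines-close L L' with spans 0# (λ i → tail L' i - tail L i - (head L' - head L) * ψ i 0#)
  ... | ps , |ps|≤m , reconstructs =
    _ , even-length-bound (≡.subst (_≤ m) (≡.sym (length-fieldPairs ps)) |ps|≤m) ,
    linesJoined⇒walk (fieldPairs ps) 0# L L' joined
    where
    joined : LinesJoined (fieldPairs ps) 0# L L'
    joined i = begin
      tail L' i
        ≈⟨ solve 3 (λ A B C → A := B :+ (A :- B :- C) :+ C) refl (tail L' i) (tail L i) (shift i) ⟩
      tail L i + (tail L' i - tail L i - shift i) + shift i
        ≈⟨ +-congʳ (+-congˡ (trans (sym (reconstructs i)) (combination≈drift 0# ps i))) ⟩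
      tail L i + drift (fieldPairs ps) 0# i + shift i ∎
      where shift = λ i → (head L' - head L) * ψ i 0#

  point-line-close : ∀ P L' s → ¬ s ≈ head P → ∃ λ n → n ≤ diam × Walk n (inj₁ P) (inj₂ L')
  point-line-close P L' s s≉a
    with spansWithPivot s (index (head P)) (λ t₀≈s → s≉a (trans (sym t₀≈s) (element-index (head P))))
                        (λ i → tail L' i + tail P i - head L' * ψ i s)
  ... | y₀ , ps , |ps|≤k , reconstructs =
    _ , odd-length-bound (≡.subst (_≤ k) (≡.sym (length-fieldPairs ps)) |ps|≤k) ,
    stepToLine L₁ (incident-lineThrough P y₀) (linesJoined⇒walk (fieldPairs ps) s L₁ L' joined)
    where
    L₁ = lineThrough P y₀
    joined : LinesJoined (fieldPairs ps) s L₁ L'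
    joined i = begin
      tail L' i
        ≈⟨ solve 6 (λ L' u x' S y₀ A → L' := (A :* y₀ :- u) :+ ((L' :+ u :- x' :* S) :- y₀ :* (A :- S)) :+ (x' :- y₀) :* S)
             refl (tail L' i) (tail P i) (head L') (ψ i s) y₀ (ψ i (head P)) ⟩
      tail L₁ i + ((tail L' i + tail P i - head L' * ψ i s) - y₀ * (ψ i (head P) - ψ i s)) + (head L' - y₀) * ψ i s
        ≈⟨ +-congʳ (+-congˡ (pivot-remainder (element-index (head P)) y₀ ps i (reconstructs i))) ⟩
      tail L₁ i + drift (fieldPairs ps) s i + (head L' - y₀) * ψ i s ∎

  line-point-close : ∀ L Q s → ¬ s ≈ head Q → ∃ λ n → n ≤ diam × Walk n (inj₂ L) (inj₁ Q)
  line-point-close L Q s s≉a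
    with spansWithPivot (head Q) (index s) (λ t₀≈a → s≉a (trans (sym (element-index s)) t₀≈a))
                        (λ i → tail Q i + tail L i - head L * ψ i (head Q))
  ... | y₀ , ps , |ps|≤k , reconstructs =
    _ , odd-length-bound (≡.subst (_≤ k) (≡.sym (length-fieldPairs ps)) |ps|≤k) ,
    stepToPoint P₁ (incident-pointOn L s) (pointsJoined⇒walk (fieldPairs ps) (head L - y₀) P₁ Q joined)
    where
    P₁ = pointOn L s
    joined : PointsJoined (fieldPairs ps) (head L - y₀) P₁ Q
    joined i = begin
      tail Q i
        ≈⟨ solve 6 (λ v l x A S y₀ → v := (S :* x :- l) :+ (x :- y₀) :* (A :- S) :+ ((v :+ l :- x :* A) :- y₀ :* (S :- A)))
             refl (tail Q i) (tail L i) (head L) (ψ i (head Q)) (ψ i s) y₀ ⟩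
      tail P₁ i + (head L - y₀) * (ψ i (head Q) - ψ i s) + ((tail Q i + tail L i - head L * ψ i (head Q)) - y₀ * (ψ i s - ψ i (head Q)))
        ≈⟨ +-congˡ (pivot-remainder (element-index s) y₀ ps i (reconstructs i)) ⟩
      tail P₁ i + (head L - y₀) * (ψ i (head Q) - ψ i s) + drift (fieldPairs ps) (head Q) i ∎

  diameter≤ : ∀ u v → ∃ λ n → n ≤ diam × Walk n u v
  diameter≤ (inj₁ P) (inj₁ Q)  = points-close P Q
  diameter≤ (inj₂ L) (inj₂ L') = lines-close L L'
  diameter≤ (inj₁ P) (inj₂ L') = point-line-close P L' (proj₁ (another (head P))) (proj₂ (another (head P)))
  diameter≤ (inj₂ L) (inj₁ Q)  = line-point-close L Q (proj₁ (another (head Q))) (proj₂ (another (head Q)))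

module LowerBound {c ℓ} (F : Field c ℓ) {p : ℕ} (k : ℕ) (p-prime : Prime p)
                  (p≈0 : Field._≈_ F (FieldProperties.ofℕ F p) (Field.0# F)) where
  open FieldProperties F
  open LGraph F p (suc k)
  open Geometry F p (suc k)
  open Frobenius F p-prime p≈0 using (φ; φ-0)
  open Moore F p-prime p≈0

  m : ℕ
  m = suc k

  lastUnit : Fin m → Carrier
  lastUnit i with toℕ i ℕ.≟ k
  ... | yes _ = 1#
  ... | no  _ = 0#

  lastUnit-last : lastUnit (fromℕ k) ≈ 1#
  lastUnit-last with toℕ (fromℕ k) ℕ.≟ k
  ... | yes _   = refl
  ... | no  ≢k  = ⊥-elim (≢k (FinP.toℕ-fromℕ k))

  lastUnit-other : ∀ i → ¬ toℕ i ≡.≡ k → lastUnit i ≈ 0#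
  lastUnit-other i ≢k with toℕ i ℕ.≟ k
  ... | yes ≡k = ⊥-elim (≢k ≡k)
  ... | no  _  = refl

  origin : Coord
  origin _ = 0#

  target : Coord
  target = 0# ◂ lastUnit

  drift-origin : ∀ ps i → drift ps 0# i ≈ frobeniusSum ps (toℕ i)
  drift-origin []             i = refl
  drift-origin ((t , y) ∷ ps) i = +-cong (*-congˡ ψt-ψ0≈φt) (drift-origin ps i)
    where
    ψt-ψ0≈φt : ψ i t - ψ i 0# ≈ φ (toℕ i) t
    ψt-ψ0≈φt = begin
      ψ i t - ψ i 0#                  ≈⟨ +-cong (pow≈^ t (p ℕ.^ toℕ i)) (-‿cong (trans (pow≈^ 0# (p ℕ.^ toℕ i)) (φ-0 (toℕ i)))) ⟩
      φ (toℕ i) t - 0#                ≈⟨ solve 1 (λ x → x :- con (ℤ.+ 0) := x) refl _ ⟩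
      φ (toℕ i) t                     ∎

  -- A walk from origin to target makes frobeniusSum ps the last unit vector,
  -- which frobeniusSum-vanishes forbids when ps has fewer than m terms.
  far : ∀ n → Walk n (inj₁ origin) (inj₁ target) → 2 ℕ.* (m ℕ.+ 1) ≤ n
  far n walk with walk⇒pointsJoined origin target walk
  ... | inj₁ (_ , origin≈target) = ⊥-elim (0≉1 (trans (origin≈target (fsuc (fromℕ k))) lastUnit-last))
  ... | inj₂ (ps , z , ≡.refl , joined) with m ℕ.≤? length ps
  ...   | yes m≤|ps| = ≡.subst (_≤ suc (length ps) ℕ.* 2) (≡.sym (2*[n+1]≡[1+n]*2 m)) (ℕP.*-monoˡ-≤ 2 (s≤s m≤|ps|))
  ...   | no  m≰|ps| = ⊥-elim (0≉1 (begin
    0#                                 ≈⟨ frobeniusSum-vanishes k ps (ℕP.≤-pred (ℕP.≰⇒> m≰|ps|)) below ⟨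
    frobeniusSum ps k                  ≡⟨ ≡.cong (frobeniusSum ps) (FinP.toℕ-fromℕ k) ⟨
    frobeniusSum ps (toℕ (fromℕ k))    ≈⟨ coordinate (fromℕ k) ⟨
    lastUnit (fromℕ k)                 ≈⟨ lastUnit-last ⟩
    1#                                 ∎))
    where
    coordinate : ∀ i → lastUnit i ≈ frobeniusSum ps (toℕ i)
    coordinate i = begin
      lastUnit i                                  ≈⟨ joined i ⟩
      0# + z * (ψ i 0# - ψ i 0#) + drift ps 0# i  ≈⟨ +-cong (solve 2 (λ z A → con (ℤ.+ 0) :+ z :* (A :- A) := con (ℤ.+ 0)) refl z (ψ i 0#))
                                                            (drift-origin ps i) ⟩
      0# + frobeniusSum ps (toℕ i)                ≈⟨ +-identityˡ _ ⟩
      frobeniusSum ps (toℕ i)                     ∎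
    below : ∀ j → j < k → frobeniusSum ps j ≈ 0#
    below j j<k = begin
      frobeniusSum ps j                    ≡⟨ ≡.cong (frobeniusSum ps) (FinP.toℕ-fromℕ< j<m) ⟨
      frobeniusSum ps (toℕ (fromℕ< j<m))   ≈⟨ coordinate (fromℕ< j<m) ⟨
      lastUnit (fromℕ< j<m)                ≈⟨ lastUnit-other (fromℕ< j<m) (λ j≡k → ℕP.<-irrefl (≡.trans (≡.sym (FinP.toℕ-fromℕ< j<m)) j≡k) j<k) ⟩
      0#                                   ∎
      where j<m = ℕP.<-trans j<k (ℕP.n<1+n k)

open import Data.Nat using (_^_; _*_; _+_)

theorem4p1 : ∀ {c ℓ : Level} (p e m : ℕ) → Prime p → 1 ≤ e → 1 ≤ m → m ≤ e →
    (F : Field c ℓ) → HasOrder F (p ^ e) →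
    HasDiameter F p m (2 * (m + 1))
theorem4p1 p e (suc k) p-prime _ _ m≤e F F↔Fin = diameter≤ , inj₁ origin , inj₁ target , far
  where
  open FiniteField F F↔Fin using (p^e-order⇒p≈0)
  open UpperBound F k F↔Fin (prime⇒1<p p-prime) ≡.refl m≤e using (diameter≤)
  open LowerBound F k p-prime (p^e-order⇒p≈0 p e ≡.refl) using (origin; target; far)
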